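{- Let $(X,\le)$ be an ideally effective WQO and $E$ an equivalence relation on $X$ compatible with $\le$, i.e., ${\le}\circ E=E\circ{\le}$, and let ${\le_E}={\le}\circ E$. Represent elements of $(X,\le_E)$ by the same data structure as for $(X,\le)$, and represent an ideal $J$ of $(X,\le_E)$ by (the representation of) any ideal $I$ of $(X,\le)$ with $J=\downarrow_{\le_E}I$. Then $(X,\le_E)$ is ideally effective for these representations whenever the following functions are computable: $c_I:\mathrm{Idl}(X,\le)\to\mathrm{Down}(X,\le)$, $I\mapsto\overline I$, and $c_F:\mathrm{Fil}(X,\le)\to\mathrm{Up}(X,\le)$, $\uparrow x\mapsto\uparrow\overline x$. Moreover, under these assumptions, a presentation of $(X,\le_E)$ can be computed from a presentation of $(X,\le)$.
   Context: A quasi-ordering (QO) $(X,\le)$ is a set with a reflexive transitive relation; it is a well-quasi-ordering (WQO) if every infinite sequence $(x_k)_k$ has $i<j$ with $x_i\le x_j$. $\circ$ denotes composition of relations; under compatibility, $\le_E$ is a quasi-ordering extending $\le$. For $S\subseteq X$, $\overline S=\{y\mid\exists x\in S: x\,E\,y\}$ is the closure of $S$ under $E$ and $\overline x=\overline{\{x\}}$. $\uparrow S=\{x\mid \exists y\in S: y\le x\}$ and $\downarrow S=\{x\mid\exists y\in S: x\le y\}$ (subscripts indicate the ordering used); $S$ is upwards-closed if $S=\uparrow S$ and downwards-closed if $S=\downarrow S$; $\mathrm{Up}(X,\le)$, $\mathrm{Down}(X,\le)$ are the sets of such subsets. An ideal is a non-empty, downwards-closed, directed subset; $\mathrm{Idl}(X,\le)$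 is the set of ideals. In a WQO the filters are the sets $\uparrow x$; $\mathrm{Fil}(X,\le)$ is the set of filters. In a WQO every upwards-closed set is a finite union of filters and every downwards-closed set is a finite union of ideals; upwards-closed (resp. downwards-closed) sets are represented as finite lists of filters (resp. ideals), a filter $\uparrow x$ being represented by $x$. A WQO equipped with data structures (recursive sets of representations) for elements and ideals is ideally effective if: (OD) the order is decidable; (ID) inclusion is decidable between ideals; (PI) $x\mapsto\downarrow x$ is computable; (CF) the complement $X\setminus\uparrow x$ of a filter is computable as a finite union of ideals; (IF) the intersection of two filters is computable as a finite union of filters; (CI) the complement of an ideal is computable as a finite union of filters; (II) the intersection of two ideals is computable as a finite union of ideals. A presentation of an ideally effective WQO consists of the data structures, algorithms for these seven operations, a decomposition of $X$ as a finite union of ideals, and a decomposition of $X$ as a finite union of filters. -}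

module Defs where

open import Level using (0ℓ)
open import Data.Nat using (ℕ; _<_)
open import Data.Product using (Σ; ∃; ∃-syntax; _×_; _,_)
open import Data.List using (List)
open import Data.List.Relation.Unary.Any using (Any)
open import Relation.Nullary using (Dec; ¬_)
open import Relation.Unary using (Pred; _∈_; _⊆_)
open import Relation.Binary using (Rel; Decidable; IsEquivalence)
open import Function.Bundles using (_⇔_)
open import Relation.Binary.PropositionalEquality using (_≡_)

infixr 9 _∘ᴿ_
_∘ᴿ_ : {X : Set} → Rel X 0ℓ → Rel X 0ℓ → Rel X 0ℓ
R ∘ᴿ S = λ x y → ∃[ z ] (R x z × S z y)

module _ {X : Set} (_≤_ : Rel X 0ℓ) where

  record IsQO : Set where
    field
      refl  : ∀ x → x ≤ x
      trans : ∀ {x y z} → x ≤ y → y ≤ z → x ≤ z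

  IsWQO : Set
  IsWQO = IsQO × (∀ (f : ℕ → X) → ∃[ i ] ∃[ j ] (i < j × f i ≤ f j))

  ↑ : Pred X 0ℓ → Pred X 0ℓ
  ↑ S x = ∃[ y ] (y ∈ S × y ≤ x)

  ↓ : Pred X 0ℓ → Pred X 0ℓ
  ↓ S x = ∃[ y ] (y ∈ S × x ≤ y)

  DownwardsClosed : Pred X 0ℓ → Set
  DownwardsClosed S = ↓ S ⊆ S

  record IsIdeal (I : Pred X 0ℓ) : Set where
    field
      nonEmpty   : ∃[ x ] (x ∈ I)
      downClosed : DownwardsClosed I
      directed   : ∀ {x y} → x ∈ I → y ∈ I → ∃[ z ] (z ∈ I × x ≤ z × y ≤ z)

｛_｝ : {X : Set} → X → Pred X 0ℓ
｛ x ｝ y = x ≡ y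

_≐_ : {X : Set} → Pred X 0ℓ → Pred X 0ℓ → Set
S ≐ T = ∀ z → (z ∈ S) ⇔ (z ∈ T)

⋃ : {X A : Set} → (A → Pred X 0ℓ) → List A → Pred X 0ℓ
⋃ ⟦_⟧ as z = Any (λ a → z ∈ ⟦ a ⟧) as

closure : {X : Set} → Rel X 0ℓ → Pred X 0ℓ → Pred X 0ℓ
closure E S y = ∃[ x ] (x ∈ S × E x y)

-- An upwards-closed set is a finite list of elements x (standing
-- for the filters ↑x), a downwards-closed set is a finite list of ideal
-- representations.  "Computable" = given by an Agda function.

record Presentation {X : Set} (_≤_ : Rel X 0ℓ)
                    (Idl : Set) (⟦_⟧ : Idl → Pred X 0ℓ) : Set₁ where
  Fil : X → Pred X 0ℓ
  Fil x = ↑ _≤_ ｛ x ｝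
  field
    isWQO    : IsWQO _≤_
    ⟦⟧-ideal : ∀ I → IsIdeal _≤_ ⟦ I ⟧
    OD : Decidable _≤_
    ID : (I J : Idl) → Dec (⟦ I ⟧ ⊆ ⟦ J ⟧)
    PI         : X → Idl
    PI-correct : ∀ x → ⟦ PI x ⟧ ≐ ↓ _≤_ ｛ x ｝
    CF         : X → List Idl
    CF-correct : ∀ x → (λ z → ¬ (z ∈ Fil x)) ≐ ⋃ ⟦_⟧ (CF x)
    IF         : X → X → List X
    IF-correct : ∀ x y → (λ z → z ∈ Fil x × z ∈ Fil y) ≐ ⋃ Fil (IF x y)
    CI         : Idl → List X
    CI-correct : ∀ I → (λ z → ¬ (z ∈ ⟦ I ⟧)) ≐ ⋃ Fil (CI I)
    II         : Idl → Idl → List Idl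
    II-correct : ∀ I J → (λ z → z ∈ ⟦ I ⟧ × z ∈ ⟦ J ⟧) ≐ ⋃ ⟦_⟧ (II I J)
    idlDecomp         : List Idl
    idlDecomp-correct : ∀ z → z ∈ ⋃ ⟦_⟧ idlDecomp
    filDecomp         : List X
    filDecomp-correct : ∀ z → z ∈ ⋃ Fil filDecomp

{-# OPTIONS --safe #-}
module Submission where

-- Compatibility of E with ≤ makes ≤E = ≤ ∘ E transitive and identifies the
-- ≤E-ideal ↓≤E I with the closure Ī, and the ≤E-filter ↑≤E x with ↑ x̄.  Through
-- c_I and c_F, every ≤E-ideal and ≤E-filter is therefore a finite union of
-- ≤-ideals or ≤-filters, whose intersections and complements are computed in
-- (X, ≤) by distributivity and De Morgan; being ≤E-closed, each result is also
-- the union of the ≤E-ideals or ≤E-filters generated by the same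
-- representations.  Inclusion ↓≤E I ⊆ ↓≤E J amounts to I ⊆ ⋃ c_I(J), which is
-- decidable because an ideal covered by finitely many downwards-closed sets is
-- contained in one of them.

open import Defs
open import Level using (0ℓ)
open import Data.List using (List; []; _∷_; foldr; concat; cartesianProductWith)
open import Data.List.Relation.Unary.Any as Any using (Any; here; there; any?)
open import Data.List.Relation.Unary.Any.Properties
  using (concat⁺; concat⁻; cartesianProductWith⁺; cartesianProductWith⁻)
open import Data.List.Relation.Unary.All using (All; []; _∷_)
open import Data.List.Relation.Unary.All.Properties using (¬Any⇒All¬)
open import Data.List.Membership.Propositional using (find; lose)
open import Data.Product using (_,_; proj₁; proj₂)
open import Data.Product.Function.NonDependent.Propositional using (_×-⇔_)
open import Data.Empty using (⊥-elim)
open import Function using (_∘_; flip)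
open import Function.Bundles using (_⇔_; mk⇔; Equivalence)
open import Function.Related.TypeIsomorphisms using (¬-cong-⇔)
import Function.Properties.Equivalence as ⇔
open import Relation.Binary using (Rel; IsEquivalence; Transitive; Decidable)
open import Relation.Binary.PropositionalEquality using (refl)
open import Relation.Nullary using (Dec; yes; no; ¬_)
import Relation.Nullary.Decidable as Dec
open import Relation.Unary using (Pred; _∈_; _⊆_; _∩_; ∁)

open Equivalence using (to; from)

module _ {X : Set} where

  ≐-sym : {S T : Pred X 0ℓ} → S ≐ T → T ≐ S
  ≐-sym S≐T z = ⇔.sym (S≐T z)

  ≐-trans : {S T U : Pred X 0ℓ} → S ≐ T → T ≐ U → S ≐ U
  ≐-trans S≐T T≐U z = ⇔.trans (S≐T z) (T≐U z)

  ∩-cong : {S S′ T T′ : Pred X 0ℓ} → S ≐ S′ → T ≐ T′ → (S ∩ T) ≐ (S′ ∩ T′)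
  ∩-cong S≐S′ T≐T′ z = S≐S′ z ×-⇔ T≐T′ z

  ∁-cong : {S T : Pred X 0ℓ} → S ≐ T → ∁ S ≐ ∁ T
  ∁-cong S≐T z = ¬-cong-⇔ (S≐T z)

  ↓-cong : (R : Rel X 0ℓ) {S T : Pred X 0ℓ} → S ≐ T → ↓ R S ≐ ↓ R T
  ↓-cong R S≐T z = mk⇔
    (λ (y , y∈S , zRy) → y , to (S≐T y) y∈S , zRy)
    (λ (y , y∈T , zRy) → y , from (S≐T y) y∈T , zRy)

  ⊆-respˡ-≐ : {S T U : Pred X 0ℓ} → S ≐ T → (S ⊆ U) ⇔ (T ⊆ U)
  ⊆-respˡ-≐ S≐T = mk⇔ (λ S⊆U {z} z∈T → S⊆U (from (S≐T z) z∈T)) (λ T⊆U {z} z∈S → T⊆U (to (S≐T z) z∈S))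

  ⊆-respʳ-≐ : {S T U : Pred X 0ℓ} → T ≐ U → (S ⊆ T) ⇔ (S ⊆ U)
  ⊆-respʳ-≐ T≐U = mk⇔ (λ S⊆T {z} z∈S → to (T≐U z) (S⊆T z∈S)) (λ S⊆U {z} z∈S → from (T≐U z) (S⊆U z∈S))

  ∈⇔｛｝⊆ : {x : X} {S : Pred X 0ℓ} → (x ∈ S) ⇔ (｛ x ｝ ⊆ S)
  ∈⇔｛｝⊆ = mk⇔ (λ { x∈S refl → x∈S }) (λ ｛x｝⊆S → ｛x｝⊆S refl)

module FiniteUnions {X T : Set} (D : T → Pred X 0ℓ)
                    (meet : T → T → List T)
                    (meet-≐ : ∀ a b → (D a ∩ D b) ≐ ⋃ D (meet a b)) where

  intersect : List T → List T → List T
  intersect as bs = concat (cartesianProductWith meet as bs)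

  intersect-≐ : ∀ as bs → (⋃ D as ∩ ⋃ D bs) ≐ ⋃ D (intersect as bs)
  intersect-≐ as bs z = mk⇔
    (λ (z∈as , z∈bs) → concat⁺ (cartesianProductWith⁺ meet
      (λ z∈a z∈b → to (meet-≐ _ _ z) (z∈a , z∈b)) z∈as z∈bs))
    (λ z∈⋃ → cartesianProductWith⁻ meet (from (meet-≐ _ _ z)) as bs (concat⁻ _ z∈⋃))

  module _ {U : Set} (D′ : U → Pred X 0ℓ)
           (co : U → List T) (co-≐ : ∀ u → ∁ (D′ u) ≐ ⋃ D (co u))
           (whole : List T) (whole-covers : ∀ z → z ∈ ⋃ D whole) where

    complement : List U → List T
    complement = foldr (intersect ∘ co) whole

    complement-≐ : ∀ us → ∁ (⋃ D′ us) ≐ ⋃ D (complement us)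
    complement-≐ [] z = mk⇔ (λ _ → whole-covers z) (λ _ ())
    complement-≐ (u ∷ us) =
      ≐-trans ∁-⋃-∷ (≐-trans (∩-cong (co-≐ u) (complement-≐ us))
                             (intersect-≐ (co u) (complement us)))
      where
      ∁-⋃-∷ : ∁ (⋃ D′ (u ∷ us)) ≐ (∁ (D′ u) ∩ ∁ (⋃ D′ us))
      ∁-⋃-∷ z = mk⇔ (λ z∉ → z∉ ∘ here , z∉ ∘ there)
                    (λ { (z∉u , _) (here z∈u) → z∉u z∈u
                       ; (_ , z∉us) (there z∈us) → z∉us z∈us })

module _ {X : Set} {_≤_ : Rel X 0ℓ} where

  ∈↑｛｝⇔≤ : {x y : X} → (y ∈ ↑ _≤_ ｛ x ｝) ⇔ (x ≤ y)
  ∈↑｛｝⇔≤ = mk⇔ (λ { (_ , refl , x≤y) → x≤y }) (λ x≤y → _ , refl , x≤y)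

  ↓-downwardsClosed : Transitive _≤_ → (S : Pred X 0ℓ) → DownwardsClosed _≤_ (↓ _≤_ S)
  ↓-downwardsClosed ≤-trans S (y , (w , w∈S , y≤w) , z≤y) = w , w∈S , ≤-trans z≤y y≤w

  -- ↑ R is definitionally ↓ (flip R), so upwards-closed sets are stated as
  -- DownwardsClosed (flip R).
  ∁-downwardsClosed : {S : Pred X 0ℓ} → DownwardsClosed (flip _≤_) S → DownwardsClosed _≤_ (∁ S)
  ∁-downwardsClosed S-up {z} (y , y∉S , z≤y) z∈S = y∉S (S-up (z , z∈S , z≤y))

  ∩-downwardsClosed : {S T : Pred X 0ℓ} → DownwardsClosed _≤_ S → DownwardsClosed _≤_ T →
                      DownwardsClosed _≤_ (S ∩ T)
  ∩-downwardsClosed S-down T-down (y , (y∈S , y∈T) , z≤y) =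
    S-down (y , y∈S , z≤y) , T-down (y , y∈T , z≤y)

  ↓⊆⇔⊆ : (∀ x → x ≤ x) → {S T : Pred X 0ℓ} → DownwardsClosed _≤_ T → (↓ _≤_ S ⊆ T) ⇔ (S ⊆ T)
  ↓⊆⇔⊆ ≤-refl T-down = mk⇔
    (λ ↓S⊆T {z} z∈S → ↓S⊆T (z , z∈S , ≤-refl z))
    (λ S⊆T {z} (y , y∈S , z≤y) → T-down (y , S⊆T y∈S , z≤y))

  ⋃-≐-between : {A : Set} {D D′ : A → Pred X 0ℓ} {S : Pred X 0ℓ} {as : List A} →
                DownwardsClosed _≤_ S → S ≐ ⋃ D as →
                (∀ {a} → D a ⊆ D′ a) → (∀ {a} → D′ a ⊆ ↓ _≤_ (D a)) → S ≐ ⋃ D′ as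
  ⋃-≐-between S-down S≐⋃D D⊆D′ D′⊆↓D z = mk⇔
    (Any.map D⊆D′ ∘ to (S≐⋃D z))
    (λ z∈⋃D′ → let (a , a∈as , z∈D′a) = find z∈⋃D′
                   (y , y∈Da , z≤y) = D′⊆↓D z∈D′a
               in S-down (y , from (S≐⋃D y) (lose a∈as y∈Da) , z≤y))

  module _ (qo : IsQO _≤_) {I : Pred X 0ℓ} (I-ideal : IsIdeal _≤_ I)
           {A : Set} {D : A → Pred X 0ℓ}
           (D-down : ∀ a → DownwardsClosed _≤_ (D a)) (∈D? : ∀ a x → Dec (x ∈ D a)) where
    open IsQO qo renaming (refl to ≤-refl; trans to ≤-trans)
    open IsIdeal I-ideal

    -- Assuming the cover only above x lets the induction move x up inside I.
    uncoveredAbove : ∀ {as} → All (λ a → ¬ (I ⊆ D a)) as →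
                ∀ {x} → x ∈ I → ¬ (∀ {w} → w ∈ I → x ≤ w → w ∈ ⋃ D as)
    uncoveredAbove [] {x} x∈I cover with cover x∈I (≤-refl x)
    ... | ()
    uncoveredAbove {a ∷ as} (I⊈Da ∷ I⊈Ds) {x} x∈I cover = I⊈Da I⊆Da
      where
      I⊆Da : I ⊆ D a
      I⊆Da {y} y∈I with ∈D? a y
      ... | yes y∈Da = y∈Da
      ... | no y∉Da with directed x∈I y∈I
      ...   | w , w∈I , x≤w , y≤w = ⊥-elim (uncoveredAbove I⊈Ds w∈I coverAbove-w)
        where
        coverAbove-w : ∀ {v} → v ∈ I → w ≤ v → v ∈ ⋃ D as
        coverAbove-w v∈I w≤v with cover v∈I (≤-trans x≤w w≤v)
        ... | here v∈Da = ⊥-elim (y∉Da (D-down a (_ , v∈Da , ≤-trans y≤w w≤v)))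
        ... | there v∈Ds = v∈Ds

    ideal-⊆-⋃? : (∀ a → Dec (I ⊆ D a)) → ∀ as → Dec (I ⊆ ⋃ D as)
    ideal-⊆-⋃? I⊆? as with any? I⊆? as
    ... | yes some = yes (λ z∈I → Any.map (λ I⊆Da → I⊆Da z∈I) some)
    ... | no none = no (λ I⊆⋃ →
      uncoveredAbove (¬Any⇒All¬ as none) (proj₂ nonEmpty) (λ w∈I _ → I⊆⋃ w∈I))

module _ {X : Set} {_≤_ _≤′_ : Rel X 0ℓ} (qo : IsQO _≤_) (qo′ : IsQO _≤′_)
         (≤⇒≤′ : ∀ {x y} → x ≤ y → x ≤′ y) where
  open IsQO qo′ renaming (refl to ≤′-refl; trans to ≤′-trans)

  isWQO-coarser : IsWQO _≤_ → IsWQO _≤′_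
  isWQO-coarser (_ , good) = qo′ , λ f →
    let (i , j , i<j , fi≤fj) = good f in i , j , i<j , ≤⇒≤′ fi≤fj

  ↓-isIdeal-coarser : {I : Pred X 0ℓ} → IsIdeal _≤_ I → IsIdeal _≤′_ (↓ _≤′_ I)
  ↓-isIdeal-coarser I-ideal = record
    { nonEmpty = let (x , x∈I) = nonEmpty in x , x , x∈I , ≤′-refl x
    ; downClosed = ↓-downwardsClosed ≤′-trans _
    ; directed = λ (a , a∈I , x≤a) (b , b∈I , y≤b) →
        let (c , c∈I , a≤c , b≤c) = directed a∈I b∈I
        in c , (c , c∈I , ≤′-refl c) , ≤′-trans x≤a (≤⇒≤′ a≤c) , ≤′-trans y≤b (≤⇒≤′ b≤c)
    }
    where open IsIdeal I-ideal

  ↓-↓-coarser : (S : Pred X 0ℓ) → ↓ _≤′_ (↓ _≤_ S) ≐ ↓ _≤′_ S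
  ↓-↓-coarser S z = mk⇔
    (λ (y , (w , w∈S , y≤w) , z≤y) → w , w∈S , ≤′-trans z≤y (≤⇒≤′ y≤w))
    (λ (y , y∈S , z≤y) → y , (y , y∈S , IsQO.refl qo y) , z≤y)

module Compatible {X : Set} {_≤_ : Rel X 0ℓ} (qo : IsQO _≤_)
                  {E : Rel X 0ℓ} (E-equiv : IsEquivalence E)
                  (compat : ∀ x y → (_≤_ ∘ᴿ E) x y ⇔ (E ∘ᴿ _≤_) x y) where
  open IsQO qo renaming (refl to ≤-refl; trans to ≤-trans)
  private module E = IsEquivalence E-equiv

  _≤E_ : Rel X 0ℓ
  _≤E_ = _≤_ ∘ᴿ E

  ≤⇒≤E : ∀ {x y} → x ≤ y → x ≤E y
  ≤⇒≤E x≤y = _ , x≤y , E.refl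

  ≤E-isQO : IsQO _≤E_
  ≤E-isQO = record
    { refl = λ x → ≤⇒≤E (≤-refl x)
    ; trans = λ {_} {y} (a , x≤a , a~y) (b , y≤b , b~z) →
        let (c , a≤c , c~b) = from (compat a b) (y , a~y , y≤b)
        in c , ≤-trans x≤a a≤c , E.trans c~b b~z
    }

  ↓≤E-≐-closure : {S : Pred X 0ℓ} → DownwardsClosed _≤_ S → ↓ _≤E_ S ≐ closure E S
  ↓≤E-≐-closure S-down z = mk⇔
    (λ (y , y∈S , w , z≤w , w~y) →
       let (v , z~v , v≤y) = to (compat z y) (w , z≤w , w~y)
       in v , S-down (y , y∈S , v≤y) , E.sym z~v)
    (λ (x , x∈S , x~z) → x , x∈S , z , ≤-refl z , E.sym x~z)

  ↑≤E-≐-↑closure : (S : Pred X 0ℓ) → ↑ _≤E_ S ≐ ↑ _≤_ (closure E S)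
  ↑≤E-≐-↑closure S z = mk⇔
    (λ (y , y∈S , w , y≤w , w~z) →
       let (v , y~v , v≤z) = to (compat y z) (w , y≤w , w~z)
       in v , (y , y∈S , y~v) , v≤z)
    (λ (v , (y , y∈S , y~v) , v≤z) → y , y∈S , from (compat y z) (v , y~v , v≤z))

module PresentationProperties {X : Set} {_≤_ : Rel X 0ℓ} {Idl : Set} {⟦_⟧ : Idl → Pred X 0ℓ}
                              (Pr : Presentation _≤_ Idl ⟦_⟧) where
  open Presentation Pr

  ∈⇔PI⊆ : ∀ x I → (x ∈ ⟦ I ⟧) ⇔ (⟦ PI x ⟧ ⊆ ⟦ I ⟧)
  ∈⇔PI⊆ x I = ⇔.trans ∈⇔｛｝⊆
    (⇔.trans (⇔.sym (↓⊆⇔⊆ (IsQO.refl (proj₁ isWQO)) (IsIdeal.downClosed (⟦⟧-ideal I))))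
             (⊆-respˡ-≐ (≐-sym (PI-correct x))))

  ∈⟦⟧? : ∀ x I → Dec (x ∈ ⟦ I ⟧)
  ∈⟦⟧? x I = Dec.map (⇔.sym (∈⇔PI⊆ x I)) (ID (PI x) I)

  ⊆-⋃⟦⟧? : ∀ I Js → Dec (⟦ I ⟧ ⊆ ⋃ ⟦_⟧ Js)
  ⊆-⋃⟦⟧? I = ideal-⊆-⋃? (proj₁ isWQO) (⟦⟧-ideal I)
    (IsIdeal.downClosed ∘ ⟦⟧-ideal) (flip ∈⟦⟧?) (ID I)

  ∈-⋃Fil? : ∀ x ys → Dec (x ∈ ⋃ Fil ys)
  ∈-⋃Fil? x = any? (λ y → Dec.map (⇔.sym (∈↑｛｝⇔≤ {_≤_ = _≤_})) (OD y x))

  module Idls = FiniteUnions ⟦_⟧ II II-correct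
  module Fils = FiniteUnions Fil IF IF-correct

  ∁⋃Fil : List X → List Idl
  ∁⋃Fil = Idls.complement Fil CF CF-correct idlDecomp idlDecomp-correct

  ∁⋃Fil-≐ : ∀ xs → ∁ (⋃ Fil xs) ≐ ⋃ ⟦_⟧ (∁⋃Fil xs)
  ∁⋃Fil-≐ = Idls.complement-≐ Fil CF CF-correct idlDecomp idlDecomp-correct

  ∁⋃⟦⟧ : List Idl → List X
  ∁⋃⟦⟧ = Fils.complement ⟦_⟧ CI CI-correct filDecomp filDecomp-correct

  ∁⋃⟦⟧-≐ : ∀ Is → ∁ (⋃ ⟦_⟧ Is) ≐ ⋃ Fil (∁⋃⟦⟧ Is)
  ∁⋃⟦⟧-≐ = Fils.complement-≐ ⟦_⟧ CI CI-correct filDecomp filDecomp-correct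

module Quotient {X : Set} {_≤_ : Rel X 0ℓ} {Idl : Set} {⟦_⟧ : Idl → Pred X 0ℓ}
                (Pr : Presentation _≤_ Idl ⟦_⟧)
                {E : Rel X 0ℓ} (E-equiv : IsEquivalence E)
                (compat : ∀ x y → (_≤_ ∘ᴿ E) x y ⇔ (E ∘ᴿ _≤_) x y)
                (cI : Idl → List Idl) (cI-≐ : ∀ I → closure E ⟦ I ⟧ ≐ ⋃ ⟦_⟧ (cI I))
                (cF : X → List X) (cF-≐ : ∀ x → ↑ _≤_ (closure E ｛ x ｝) ≐ ⋃ (↑ _≤_ ∘ ｛_｝) (cF x))
                where
  open Presentation Pr
  open PresentationProperties Pr
  open Compatible (proj₁ isWQO) E-equiv compat
  open IsQO ≤E-isQO renaming (refl to ≤E-refl; trans to ≤E-trans)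

  ⟦_⟧E : Idl → Pred X 0ℓ
  ⟦ I ⟧E = ↓ _≤E_ ⟦ I ⟧

  FilE : X → Pred X 0ℓ
  FilE x = ↑ _≤E_ ｛ x ｝

  ⟦⟧E-≐ : ∀ I → ⟦ I ⟧E ≐ ⋃ ⟦_⟧ (cI I)
  ⟦⟧E-≐ I = ≐-trans (↓≤E-≐-closure (IsIdeal.downClosed (⟦⟧-ideal I))) (cI-≐ I)

  FilE-≐ : ∀ x → FilE x ≐ ⋃ Fil (cF x)
  FilE-≐ x = ≐-trans (↑≤E-≐-↑closure ｛ x ｝) (cF-≐ x)

  ⟦⟧E-downwardsClosed : ∀ I → DownwardsClosed _≤E_ ⟦ I ⟧E
  ⟦⟧E-downwardsClosed I = ↓-downwardsClosed ≤E-trans ⟦ I ⟧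

  FilE-upwardsClosed : ∀ x → DownwardsClosed (flip _≤E_) (FilE x)
  FilE-upwardsClosed x = ↓-downwardsClosed (flip ≤E-trans) ｛ x ｝

  ⋃⟦⟧E-≐ : {S : Pred X 0ℓ} {Is : List Idl} →
           DownwardsClosed _≤E_ S → S ≐ ⋃ ⟦_⟧ Is → S ≐ ⋃ ⟦_⟧E Is
  ⋃⟦⟧E-≐ S-down S≐ = ⋃-≐-between S-down S≐ (λ {_} {z} z∈I → z , z∈I , ≤E-refl z) (λ z∈IE → z∈IE)

  ⋃FilE-≐ : {S : Pred X 0ℓ} {xs : List X} →
            DownwardsClosed (flip _≤E_) S → S ≐ ⋃ Fil xs → S ≐ ⋃ FilE xs
  ⋃FilE-≐ S-up S≐ = ⋃-≐-between {_≤_ = flip _≤E_} S-up S≐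
    (λ (y , x≡y , y≤z) → y , x≡y , ≤⇒≤E y≤z)
    (λ (y , x≡y , y≤z) → y , (y , x≡y , IsQO.refl (proj₁ isWQO) y) , y≤z)

  ≤E? : Decidable _≤E_
  ≤E? x y = Dec.map (⇔.trans (⇔.sym (FilE-≐ x y)) (∈↑｛｝⇔≤ {_≤_ = _≤E_})) (∈-⋃Fil? y (cF x))

  ⟦⟧E-⊆? : ∀ I J → Dec (⟦ I ⟧E ⊆ ⟦ J ⟧E)
  ⟦⟧E-⊆? I J = Dec.map
    (⇔.sym (⇔.trans (↓⊆⇔⊆ ≤E-refl (⟦⟧E-downwardsClosed J)) (⊆-respʳ-≐ (⟦⟧E-≐ J))))
    (⊆-⋃⟦⟧? I (cI J))

  presentation : Presentation _≤E_ Idl ⟦_⟧E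
  presentation = record
    { isWQO = isWQO-coarser (proj₁ isWQO) ≤E-isQO ≤⇒≤E isWQO
    ; ⟦⟧-ideal = λ I → ↓-isIdeal-coarser (proj₁ isWQO) ≤E-isQO ≤⇒≤E (⟦⟧-ideal I)
    ; OD = ≤E?
    ; ID = ⟦⟧E-⊆?
    ; PI = PI
    ; PI-correct = λ x → ≐-trans (↓-cong _≤E_ (PI-correct x))
                                 (↓-↓-coarser (proj₁ isWQO) ≤E-isQO ≤⇒≤E ｛ x ｝)
    ; CF = ∁⋃Fil ∘ cF
    ; CF-correct = λ x → ⋃⟦⟧E-≐ (∁-downwardsClosed (FilE-upwardsClosed x))
        (≐-trans (∁-cong (FilE-≐ x)) (∁⋃Fil-≐ (cF x)))
    ; IF = λ x y → Fils.intersect (cF x) (cF y)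
    ; IF-correct = λ x y → ⋃FilE-≐
        (∩-downwardsClosed (FilE-upwardsClosed x) (FilE-upwardsClosed y))
        (≐-trans (∩-cong (FilE-≐ x) (FilE-≐ y)) (Fils.intersect-≐ (cF x) (cF y)))
    ; CI = ∁⋃⟦⟧ ∘ cI
    ; CI-correct = λ I → ⋃FilE-≐ (∁-downwardsClosed {_≤_ = flip _≤E_} (⟦⟧E-downwardsClosed I))
        (≐-trans (∁-cong (⟦⟧E-≐ I)) (∁⋃⟦⟧-≐ (cI I)))
    ; II = λ I J → Idls.intersect (cI I) (cI J)
    ; II-correct = λ I J → ⋃⟦⟧E-≐
        (∩-downwardsClosed (⟦⟧E-downwardsClosed I) (⟦⟧E-downwardsClosed J))
        (≐-trans (∩-cong (⟦⟧E-≐ I) (⟦⟧E-≐ J)) (Idls.intersect-≐ (cI I) (cI J)))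
    ; idlDecomp = idlDecomp
    ; idlDecomp-correct = λ z → Any.map (λ z∈I → z , z∈I , ≤E-refl z) (idlDecomp-correct z)
    ; filDecomp = filDecomp
    ; filDecomp-correct = λ z → Any.map (λ (y , x≡y , y≤z) → y , x≡y , ≤⇒≤E y≤z) (filDecomp-correct z)
    }

mainTheorem12 : {X : Set} {_≤_ : Rel X 0ℓ} {Idl : Set} {⟦_⟧ : Idl → X → Set}
    → Presentation _≤_ Idl ⟦_⟧
    → (E : Rel X 0ℓ) → IsEquivalence E
    → (∀ x y → (_≤_ ∘ᴿ E) x y ⇔ (E ∘ᴿ _≤_) x y)
    → (cI : Idl → List Idl)
    → (∀ I → closure E ⟦ I ⟧ ≐ ⋃ ⟦_⟧ (cI I))
    → (cF : X → List X)
    → (∀ x → ↑ _≤_ (closure E ｛ x ｝) ≐ ⋃ (λ y → ↑ _≤_ ｛ y ｝) (cF x))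
    → Presentation (_≤_ ∘ᴿ E) Idl (λ I → ↓ (_≤_ ∘ᴿ E) ⟦ I ⟧)
mainTheorem12 Pr E E-equiv compat cI cI-≐ cF cF-≐ =
  Quotient.presentation Pr E-equiv compat cI cI-≐ cF cF-≐
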